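{- Let $(J_n)_{n\ge 0}$ and $(JL_n)_{n\ge 0}$ be the Jacobsthal and Jacobsthal-Lucas numbers, and for $n\ge 0$ let $$HSJ_n=\begin{bmatrix} J_n+jJ_{n+3}\\ -J_{n+1}+jJ_{n+2}\end{bmatrix},\qquad HSJL_n=\begin{bmatrix} JL_n+jJL_{n+3}\\ -JL_{n+1}+jJL_{n+2}\end{bmatrix}.$$ Then for all $n\ge 1$, $$JL_n\,HSJ_n+2\,JL_{n-1}\,HSJ_{n-1}=HSJL_{2n-1},$$ where $JL_n\,HSJ_n$ denotes the spinor $HSJ_n$ multiplied by the real scalar $JL_n$.
   Context: The Jacobsthal numbers: $J_0=0$, $J_1=1$, $J_{n+2}=J_{n+1}+2J_n$. The Jacobsthal-Lucas numbers: $JL_0=2$, $JL_1=1$, $JL_{n+2}=JL_{n+1}+2JL_n$. Here $j$ is the hyperbolic unit ($j^2=1$, $j\neq\pm1$); spinors are column vectors with two hyperbolic-number entries, added and multiplied by real scalars componentwise. -}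

module Defs where

open import Data.Nat using (ℕ; zero; suc)
open import Data.Integer using (ℤ; +_; -_) renaming (_+_ to _+ℤ_; _*_ to _*ℤ_)

J : ℕ → ℤ
J zero = + 0
J (suc zero) = + 1
J (suc (suc n)) = J (suc n) +ℤ (+ 2) *ℤ J n

JL : ℕ → ℤ
JL zero = + 2
JL (suc zero) = + 1
JL (suc (suc n)) = JL (suc n) +ℤ (+ 2) *ℤ JL n

-- Hyperbolic numbers a + j b (j² = 1) with integer components
-- (all quantities involved are integers; ℤ embeds in ℝ).
record Hyp : Set where
  constructor _+j_
  field
    re : ℤ
    hy : ℤ

_+H_ : Hyp → Hyp → Hyp
(a +j b) +H (c +j d) = (a +ℤ c) +j (b +ℤ d)

_·H_ : ℤ → Hyp → Hyp
r ·H (a +j b) = (r *ℤ a) +j (r *ℤ b)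

record Spinor : Set where
  constructor spinor
  field
    top : Hyp
    bot : Hyp

_+S_ : Spinor → Spinor → Spinor
spinor x y +S spinor z w = spinor (x +H z) (y +H w)

_·S_ : ℤ → Spinor → Spinor
r ·S spinor x y = spinor (r ·H x) (r ·H y)

HS : (ℕ → ℤ) → ℕ → Spinor
HS f n = spinor (f n +j f (suc (suc (suc n)))) ((- f (suc n)) +j f (suc (suc n)))

HSJ : ℕ → Spinor
HSJ = HS J

HSJL : ℕ → Spinor
HSJL = HS JL

-- Both J and JL satisfy u(n+2) = u(n+1) + 2u(n), so induction on b gives the addition formula
-- u(a+b+1) = u(a+1) J(b+1) + 2 u(a) J(b) for every such u.  Taking u = JL and reading it
-- entrywise, with a = n-1 and b = n, n+1, n+2, n+3, is exactly the identity of spinors.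
module Submission where

open import Defs
open import Data.Nat using (ℕ; zero; suc; _+_)
open import Data.Nat.Properties using (+-suc)
open import Data.Integer using (ℤ; +_; -_) renaming (_+_ to _+ℤ_; _*_ to _*ℤ_)
open import Data.Integer.Solver using (module +-*-Solver)
open import Relation.Binary.PropositionalEquality
  using (_≡_; refl; cong; cong₂; trans; sym; module ≡-Reasoning)
open +-*-Solver using (solve; _:=_; _:+_; _:*_; :-_; con)

JacobsthalRecurrence : (ℕ → ℤ) → Set
JacobsthalRecurrence u = ∀ n → u (suc (suc n)) ≡ u (suc n) +ℤ (+ 2) *ℤ u n

JL-recurrence : JacobsthalRecurrence JL
JL-recurrence n = refl

jacobsthal-addition : ∀ u → JacobsthalRecurrence u → ∀ a b →
  u (suc a) *ℤ J (suc b) +ℤ (+ 2) *ℤ u a *ℤ J b ≡ u (suc (b + a))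
jacobsthal-addition u rec a zero =
  solve 2 (λ x y → x :* con (+ 1) :+ con (+ 2) :* y :* con (+ 0) := x) refl (u (suc a)) (u a)
jacobsthal-addition u rec a (suc zero) =
  trans (solve 2 (λ x y → x :* con (+ 1) :+ con (+ 2) :* y :* con (+ 1) := x :+ con (+ 2) :* y)
               refl (u (suc a)) (u a))
        (sym (rec a))
jacobsthal-addition u rec a (suc (suc b)) = begin
  u (suc a) *ℤ J (suc (suc (suc b))) +ℤ (+ 2) *ℤ u a *ℤ J (suc (suc b))
    ≡⟨ regroup (u (suc a)) (u a) (J (suc b)) (J b) ⟩
  (u (suc a) *ℤ J (suc (suc b)) +ℤ (+ 2) *ℤ u a *ℤ J (suc b))
    +ℤ (+ 2) *ℤ (u (suc a) *ℤ J (suc b) +ℤ (+ 2) *ℤ u a *ℤ J b)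
    ≡⟨ cong₂ (λ p q → p +ℤ (+ 2) *ℤ q)
             (jacobsthal-addition u rec a (suc b)) (jacobsthal-addition u rec a b) ⟩
  u (suc (suc b + a)) +ℤ (+ 2) *ℤ u (suc (b + a))
    ≡⟨ rec (suc (b + a)) ⟨
  u (suc (suc (suc b) + a))
    ∎
  where
  open ≡-Reasoning
  regroup : ∀ x y q r →
    x *ℤ ((q +ℤ (+ 2) *ℤ r) +ℤ (+ 2) *ℤ q) +ℤ (+ 2) *ℤ y *ℤ (q +ℤ (+ 2) *ℤ r) ≡
    (x *ℤ (q +ℤ (+ 2) *ℤ r) +ℤ (+ 2) *ℤ y *ℤ q) +ℤ (+ 2) *ℤ (x *ℤ q +ℤ (+ 2) *ℤ y *ℤ r)
  regroup = solve 4 (λ x y q r →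
    x :* ((q :+ con (+ 2) :* r) :+ con (+ 2) :* q) :+ con (+ 2) :* y :* (q :+ con (+ 2) :* r) :=
    (x :* (q :+ con (+ 2) :* r) :+ con (+ 2) :* y :* q) :+ con (+ 2) :* (x :* q :+ con (+ 2) :* y :* r))
    refl

*-neg-+-*-neg : ∀ x y p q → x *ℤ (- p) +ℤ y *ℤ (- q) ≡ - (x *ℤ p +ℤ y *ℤ q)
*-neg-+-*-neg = solve 4 (λ x y p q → x :* (:- p) :+ y :* (:- q) := :- (x :* p :+ y :* q)) refl

HS-linear : ∀ x y f n →
  (x ·S HS f (suc n)) +S (y ·S HS f n) ≡ HS (λ k → x *ℤ f (suc k) +ℤ y *ℤ f k) n
HS-linear x y f n =
  cong₂ spinor refl (cong₂ _+j_ (*-neg-+-*-neg x y (f (suc (suc n))) (f (suc n))) refl)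

HS-cong : ∀ {f g} → (∀ k → f k ≡ g k) → ∀ n → HS f n ≡ HS g n
HS-cong f≗g n =
  cong₂ spinor (cong₂ _+j_ (f≗g n) (f≗g (suc (suc (suc n)))))
               (cong₂ _+j_ (cong -_ (f≗g (suc n))) (f≗g (suc (suc n))))

theorem3p14 : (m : ℕ) →
    (JL (suc m) ·S HSJ (suc m)) +S (((+ 2) *ℤ JL m) ·S HSJ m) ≡ HSJL (m + suc m)
theorem3p14 m rewrite +-suc m m =
  trans (HS-linear (JL (suc m)) ((+ 2) *ℤ JL m) J m)
        (HS-cong (jacobsthal-addition JL JL-recurrence m) m)
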